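{- Let $r,\chi$ be integers with $2\leq\chi\leq r+1$, and let $b$ be an integer with $0\leq b<\chi$ such that $\chi-1$ divides $r-b$ and $r-b\geq\chi-1$. Then \[\left\lceil\frac{r\chi}{\chi-1}\right\rceil\leq n(r|\chi)\leq \min\left\{2\left\lfloor\frac{r\chi}{\chi-1}\right\rfloor,\ \frac{r-b}{\chi-1}\,\chi\,(b+1)\right\}.\]
   Context: An $(r|\chi)$-graph is a simple finite $r$-regular graph with chromatic number $\chi$. $n(r|\chi)$ is the minimum order of an $(r|\chi)$-graph. -}

module Defs where

open import Data.Nat using (ℕ; zero; suc; _+_; _*_; _∸_; _≤_; _/_)
open import Data.Bool using (Bool; true; false; if_then_else_)
open import Data.Fin using (Fin)
open import Data.List using (map; allFin)
open import Data.Nat.ListAction using (sum)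
open import Data.Product using (Σ; _×_)
open import Relation.Binary.PropositionalEquality using (_≡_; _≢_)

record Graph (n : ℕ) : Set where
  field
    adj     : Fin n → Fin n → Bool
    adj-sym : ∀ u v → adj u v ≡ adj v u
    loopless : ∀ v → adj v v ≡ false
open Graph public

degree : ∀ {n} → Graph n → Fin n → ℕ
degree {n} G v = sum (map (λ w → if adj G v w then 1 else 0) (allFin n))

Regular : ∀ {n} → Graph n → ℕ → Set
Regular G r = ∀ v → degree G v ≡ r

ProperColouring : ∀ {n} → Graph n → (k : ℕ) → (Fin n → Fin k) → Set
ProperColouring G k c = ∀ u v → adj G u v ≡ true → c u ≢ c v

Colourable : ∀ {n} → Graph n → ℕ → Set
Colourable {n} G k = Σ (Fin n → Fin k) (ProperColouring G k)

ChromaticNumber : ∀ {n} → Graph n → ℕ → Set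
ChromaticNumber G χ = Colourable G χ × (∀ k → Colourable G k → χ ≤ k)

RChiGraph : ∀ {n} → Graph n → ℕ → ℕ → Set
RChiGraph G r χ = Regular G r × ChromaticNumber G χ

-- floor and ceiling division (divisor 0 gives 0; only used with divisor ≥ 1)
floorDiv : ℕ → ℕ → ℕ
floorDiv a zero = 0
floorDiv a (suc d) = a / suc d

ceilDiv : ℕ → ℕ → ℕ
ceilDiv a zero = 0
ceilDiv a (suc d) = (a + d) / suc d

module Submission where

-- Let G be r-regular on n vertices with a proper χ-colouring.  Some colour
-- class has at least n / χ vertices; a vertex v in it has its r neighbours outside the
-- class, so r + n / χ ≤ n, i.e. χ r + n ≤ χ n (`order-bound`), which rearranges to
-- ⌈ r χ / (χ - 1) ⌉ ≤ n.
--
-- Write r - b = q (χ - 1).  The blow-up (module `Blowup`) has t copies of the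
-- complete χ-partite graph with parts of size q; vertex (i, j, c) sits in copy i, row j
-- and part c.  Two vertices of different copies are adjacent iff they share a row and
-- their parts satisfy (c + c') mod χ < b.  Each vertex has q (χ - 1) neighbours in its own
-- copy and b in every other one, so the graph is (q (χ - 1) + (t - 1) b)-regular.  For
-- t ≤ 2, colouring copy 0 by c and copy 1 by χ - 1 - c is proper, while one row of a copy
-- is a χ-clique, so the chromatic number is χ.  Taking t = 1 when b = 0 and t = 2
-- otherwise gives an (r|χ)-graph on t q χ vertices, within both upper bounds.

open import Defs
open import Data.Bool using (Bool; true; false; if_then_else_; not; _∧_; T)
open import Data.Empty using (⊥-elim)
open import Data.Fin using (Fin; zero; suc; toℕ; fromℕ<; opposite; combine; remQuot; _↑ˡ_; _↑ʳ_; punchIn)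
open import Data.Fin.Permutation using (permutation)
open import Data.Fin.Properties
  using (toℕ-fromℕ<; toℕ-injective; toℕ<n; punchInᵢ≢i; opposite-prop; opposite-involutive; remQuot-combine; pigeonhole)
  renaming (_≟_ to _≟ᶠ_; <⇒≢ to <⇒≢ᶠ)
open import Data.List using (map; allFin; tabulate)
open import Data.List.Properties using (map-tabulate)
open import Data.Nat using (ℕ; zero; suc; _+_; _*_; _∸_; _≤_; _<_; _⊓_; _<ᵇ_; z≤n; s≤s; NonZero)
open import Data.Nat.Divisibility using (_∣_; divides)
open import Data.Nat.DivMod
import Data.Nat.ListAction as List
open import Data.Nat.Properties
open import Data.Product using (Σ; ∃; _×_; _,_; map₁; assocʳ′)
open import Data.Unit using (tt)
open import Function using (_∘_)
open import Relation.Binary.PropositionalEquality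
open import Relation.Nullary using (does; yes; no)
open import Relation.Nullary.Decidable using (dec-true; dec-false)
open import Algebra.Properties.CommutativeMonoid.Sum +-0-commutativeMonoid
  using (sum-syntax; sum-remove; sum-cong-≗; ∑-comm; ∑-distrib-+; ∑-permute)
open import Algebra.Properties.CommutativeSemigroup +-commutativeSemigroup using ()
  renaming (x∙yz≈y∙xz to x+[y+z]≡y+[x+z])
open import Algebra.Properties.CommutativeSemigroup *-commutativeSemigroup using (xy∙z≈xz∙y; xy∙z≈yz∙x)

ι : Bool → ℕ
ι b = if b then 1 else 0

ι≤1 : ∀ x → ι x ≤ 1
ι≤1 true  = ≤-refl
ι≤1 false = z≤n

sum-allFin : ∀ n (f : Fin n → ℕ) → List.sum (map f (allFin n)) ≡ ∑[ i < n ] f i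
sum-allFin n f = trans (cong List.sum (map-tabulate (λ i → i) f)) (sum-tabulate n f)
  where
  sum-tabulate : ∀ n (f : Fin n → ℕ) → List.sum (tabulate f) ≡ ∑[ i < n ] f i
  sum-tabulate zero    f = refl
  sum-tabulate (suc n) f = cong (f zero +_) (sum-tabulate n (f ∘ suc))

degree≡∑ : ∀ {n} (G : Graph n) v → degree G v ≡ ∑[ w < n ] ι (adj G v w)
degree≡∑ {n} G v = sum-allFin n (λ w → ι (adj G v w))

∑-const : ∀ n a → ∑[ i < n ] a ≡ n * a
∑-const zero    a = refl
∑-const (suc n) a = cong (a +_) (∑-const n a)

∑-mono : ∀ n {f g : Fin n → ℕ} → (∀ i → f i ≤ g i) → ∑[ i < n ] f i ≤ ∑[ i < n ] g i
∑-mono zero    f≤g = z≤n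
∑-mono (suc n) f≤g = +-mono-≤ (f≤g zero) (∑-mono n (f≤g ∘ suc))

∑-split : ∀ m k (f : Fin (m + k) → ℕ) →
          ∑[ v < m + k ] f v ≡ ∑[ i < m ] f (i ↑ˡ k) + ∑[ j < k ] f (m ↑ʳ j)
∑-split zero    k f = refl
∑-split (suc m) k f = trans (cong (f zero +_) (∑-split m k (f ∘ suc))) (sym (+-assoc (f zero) _ _))

∑-combine : ∀ m k (f : Fin (m * k) → ℕ) →
            ∑[ v < m * k ] f v ≡ ∑[ i < m ] ∑[ j < k ] f (combine i j)
∑-combine zero    k f = refl
∑-combine (suc m) k f =
  trans (∑-split k (m * k) f)
        (cong (∑[ j < k ] f (combine {suc m} zero j) +_) (∑-combine m k (λ v → f (k ↑ʳ v))))

∑-spike : ∀ {n} (x : Fin n) (f : Fin n → ℕ) {a b} → f x ≡ a → (∀ y → y ≢ x → f y ≡ b) →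
          ∑[ y < n ] f y ≡ a + (n ∸ 1) * b
∑-spike {suc n} x f {a} {b} fx≡a fy≡b = begin
  ∑[ y < suc n ] f y                 ≡⟨ sum-remove {i = x} f ⟩
  f x + ∑[ y < n ] f (punchIn x y)   ≡⟨ cong₂ _+_ fx≡a (sum-cong-≗ (λ y → fy≡b (punchIn x y) (punchInᵢ≢i x y))) ⟩
  a + ∑[ y < n ] b                   ≡⟨ cong (a +_) (∑-const n b) ⟩
  a + n * b                          ∎
  where open ≡-Reasoning

∑-point : ∀ {n} (x : Fin n) → ∑[ y < n ] ι (does (x ≟ᶠ y)) ≡ 1
∑-point {n} x = begin
  ∑[ y < n ] ι (does (x ≟ᶠ y))   ≡⟨ ∑-spike x _ at-x elsewhere ⟩
  1 + (n ∸ 1) * 0                ≡⟨ cong suc (*-zeroʳ (n ∸ 1)) ⟩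
  1                              ∎
  where
  open ≡-Reasoning
  at-x : ι (does (x ≟ᶠ x)) ≡ 1
  at-x rewrite dec-true (x ≟ᶠ x) refl = refl
  elsewhere : ∀ y → y ≢ x → ι (does (x ≟ᶠ y)) ≡ 0
  elsewhere y y≢x rewrite dec-false (x ≟ᶠ y) (y≢x ∘ sym) = refl

∑-average : ∀ m (f : Fin (suc m) → ℕ) → ∃ λ κ → ∑[ i < suc m ] f i ≤ suc m * f κ
∑-average zero    f = zero , ≤-refl
∑-average (suc m) f with ∑-average m (f ∘ suc)
... | κ , ∑≤ with f (suc κ) ≤? f zero
...   | yes f[1+κ]≤f0 = zero , +-monoʳ-≤ (f zero) (≤-trans ∑≤ (*-monoʳ-≤ (suc m) f[1+κ]≤f0))
...   | no  f[1+κ]≰f0 = suc κ , +-mono-≤ (<⇒≤ (≰⇒> f[1+κ]≰f0)) ∑≤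

∑-positive : ∀ n (f : Fin n → ℕ) → 0 < ∑[ i < n ] f i → ∃ λ w → 0 < f w
∑-positive (suc n) f pos with f zero in eq
... | suc _ = zero , subst (0 <_) (sym eq) (s≤s z≤n)
... | zero with ∑-positive n (f ∘ suc) pos
...   | w , f[w]>0 = suc w , f[w]>0

count-below : ∀ n b → b ≤ n → ∑[ y < n ] ι (toℕ y <ᵇ b) ≡ b
count-below n       zero    _         = trans (∑-const n 0) (*-zeroʳ n)
count-below (suc n) (suc b) (s≤s b≤n) = cong suc (count-below n b b≤n)

%-absorbˡ : ∀ m k n .{{_ : NonZero n}} → (m % n + k) % n ≡ (m + k) % n
%-absorbˡ m k n = begin
  (m % n + k) % n           ≡⟨ %-distribˡ-+ (m % n) k n ⟩
  (m % n % n + k % n) % n   ≡⟨ cong (λ x → (x + k % n) % n) (m%n%n≡m%n m n) ⟩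
  (m % n + k % n) % n       ≡⟨ %-distribˡ-+ m k n ⟨
  (m + k) % n               ∎
  where open ≡-Reasoning

%-absorbʳ : ∀ k m n .{{_ : NonZero n}} → (k + m % n) % n ≡ (k + m) % n
%-absorbʳ k m n = begin
  (k + m % n) % n   ≡⟨ cong (_% n) (+-comm k (m % n)) ⟩
  (m % n + k) % n   ≡⟨ %-absorbˡ m k n ⟩
  (m + k) % n       ≡⟨ cong (_% n) (+-comm m k) ⟩
  (k + m) % n       ∎
  where open ≡-Reasoning

module Rotation (χ : ℕ) .{{_ : NonZero χ}} where

  rotate : Fin χ → Fin χ → Fin χ
  rotate c y = fromℕ< (m%n<n (toℕ c + toℕ y) χ)

  unrotate : Fin χ → Fin χ → Fin χ
  unrotate c z = fromℕ< (m%n<n (toℕ z + (χ ∸ toℕ c)) χ)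

  shift-cancel : ∀ (c y : Fin χ) → (toℕ c + (toℕ y + (χ ∸ toℕ c))) % χ ≡ toℕ y
  shift-cancel c y = begin
    (toℕ c + (toℕ y + (χ ∸ toℕ c))) % χ   ≡⟨ cong (_% χ) (x+[y+z]≡y+[x+z] (toℕ c) (toℕ y) _) ⟩
    (toℕ y + (toℕ c + (χ ∸ toℕ c))) % χ   ≡⟨ cong (λ m → (toℕ y + m) % χ) (m+[n∸m]≡n (<⇒≤ (toℕ<n c))) ⟩
    (toℕ y + χ) % χ                       ≡⟨ [m+n]%n≡m%n (toℕ y) χ ⟩
    toℕ y % χ                             ≡⟨ m<n⇒m%n≡m (toℕ<n y) ⟩
    toℕ y                                 ∎
    where open ≡-Reasoning

  rotate-unrotate : ∀ c z → rotate c (unrotate c z) ≡ z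
  rotate-unrotate c z = toℕ-injective (begin
    toℕ (rotate c (unrotate c z))             ≡⟨ toℕ-fromℕ< _ ⟩
    (toℕ c + toℕ (unrotate c z)) % χ          ≡⟨ cong (λ m → (toℕ c + m) % χ) (toℕ-fromℕ< _) ⟩
    (toℕ c + (toℕ z + (χ ∸ toℕ c)) % χ) % χ   ≡⟨ %-absorbʳ (toℕ c) (toℕ z + (χ ∸ toℕ c)) χ ⟩
    (toℕ c + (toℕ z + (χ ∸ toℕ c))) % χ       ≡⟨ shift-cancel c z ⟩
    toℕ z                                     ∎)
    where open ≡-Reasoning

  unrotate-rotate : ∀ c y → unrotate c (rotate c y) ≡ y
  unrotate-rotate c y = toℕ-injective (begin
    toℕ (unrotate c (rotate c y))             ≡⟨ toℕ-fromℕ< _ ⟩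
    (toℕ (rotate c y) + (χ ∸ toℕ c)) % χ      ≡⟨ cong (λ m → (m + (χ ∸ toℕ c)) % χ) (toℕ-fromℕ< _) ⟩
    ((toℕ c + toℕ y) % χ + (χ ∸ toℕ c)) % χ   ≡⟨ %-absorbˡ (toℕ c + toℕ y) (χ ∸ toℕ c) χ ⟩
    (toℕ c + toℕ y + (χ ∸ toℕ c)) % χ         ≡⟨ cong (_% χ) (+-assoc (toℕ c) (toℕ y) _) ⟩
    (toℕ c + (toℕ y + (χ ∸ toℕ c))) % χ       ≡⟨ shift-cancel c y ⟩
    toℕ y                                     ∎)
    where open ≡-Reasoning

  ∑-rotate : ∀ c (g : Fin χ → ℕ) → ∑[ y < χ ] g (rotate c y) ≡ ∑[ y < χ ] g y
  ∑-rotate c g =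
    sym (∑-permute g (permutation (rotate c) (unrotate c) (rotate-unrotate c) (unrotate-rotate c)))

module Colouring {n k} (c : Fin n → Fin k) where

  classSize : Fin k → ℕ
  classSize κ = ∑[ w < n ] ι (does (c w ≟ᶠ κ))

  ∑-classSize : ∑[ κ < k ] classSize κ ≡ n
  ∑-classSize = begin
    ∑[ κ < k ] ∑[ w < n ] ι (does (c w ≟ᶠ κ))   ≡⟨ ∑-comm (λ κ w → ι (does (c w ≟ᶠ κ))) ⟩
    ∑[ w < n ] ∑[ κ < k ] ι (does (c w ≟ᶠ κ))   ≡⟨ sum-cong-≗ {n} (λ w → ∑-point (c w)) ⟩
    ∑[ w < n ] 1                                ≡⟨ ∑-const n 1 ⟩
    n * 1                                       ≡⟨ *-identityʳ n ⟩
    n                                           ∎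
    where open ≡-Reasoning

  member : ∀ κ → 0 < classSize κ → ∃ λ w → c w ≡ κ
  member κ pos with ∑-positive n (λ w → ι (does (c w ≟ᶠ κ))) pos
  ... | w , ι>0 with c w ≟ᶠ κ
  ...   | yes cw≡κ = w , cw≡κ
  ...   | no _     = ⊥-elim (n≮n 0 ι>0)

  -- The neighbours of v all avoid its colour, so its neighbourhood and its colour class
  -- are disjoint: deg v + |class of v| ≤ n.
  degree+class≤order : (G : Graph n) → ProperColouring G k c → ∀ v → degree G v + classSize (c v) ≤ n
  degree+class≤order G proper v = begin
    degree G v + classSize (c v)                                  ≡⟨ cong (_+ classSize (c v)) (degree≡∑ G v) ⟩
    ∑[ w < n ] ι (adj G v w) + ∑[ w < n ] ι (does (c w ≟ᶠ c v))   ≡⟨ ∑-distrib-+ (λ w → ι (adj G v w)) (λ w → ι (does (c w ≟ᶠ c v))) ⟨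
    ∑[ w < n ] (ι (adj G v w) + ι (does (c w ≟ᶠ c v)))            ≤⟨ ∑-mono n exclusive ⟩
    ∑[ w < n ] 1                                                  ≡⟨ ∑-const n 1 ⟩
    n * 1                                                         ≡⟨ *-identityʳ n ⟩
    n                                                             ∎
    where
    open ≤-Reasoning
    exclusive : ∀ w → ι (adj G v w) + ι (does (c w ≟ᶠ c v)) ≤ 1
    exclusive w with adj G v w in v~w
    ... | false = ι≤1 _
    ... | true  = ≤-reflexive (cong (λ d → suc (ι d)) (dec-false (c w ≟ᶠ c v) λ same → proper v w v~w (sym same)))

  large-class-bound : ∀ {r} (G : Graph n) → Regular G r → ProperColouring G k c →
    ∀ κ → 0 < n → n ≤ k * classSize κ → k * r + n ≤ k * n
  large-class-bound {r} G regular proper κ 0<n n≤k*size with member κ nonempty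
    where
    nonempty : 0 < classSize κ
    nonempty = *-cancelˡ-< k 0 (classSize κ) (subst (_< k * classSize κ) (sym (*-zeroʳ k)) (<-≤-trans 0<n n≤k*size))
  ... | v , refl = begin
    k * r + n                     ≤⟨ +-monoʳ-≤ (k * r) n≤k*size ⟩
    k * r + k * classSize (c v)   ≡⟨ *-distribˡ-+ k r (classSize (c v)) ⟨
    k * (r + classSize (c v))     ≤⟨ *-monoʳ-≤ k (subst (λ d → d + classSize (c v) ≤ n) (regular v) (degree+class≤order G proper v)) ⟩
    k * n                         ∎
    where open ≤-Reasoning

order-bound : ∀ {n r k} (G : Graph n) → Regular G r → Colourable G k → 0 < n → k * r + n ≤ k * n
order-bound {suc _} {k = zero} G _ (c , _) _ with c zero
... | ()
order-bound {k = suc m} G regular (c , proper) 0<n with ∑-average m (Colouring.classSize c)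
... | κ , average =
  Colouring.large-class-bound c G regular proper κ 0<n
    (subst (_≤ suc m * Colouring.classSize c κ) (Colouring.∑-classSize c) average)

ceilDiv-≤ : ∀ a d n → a ≤ n * d → ceilDiv a d ≤ n
ceilDiv-≤ a zero    n _    = z≤n
ceilDiv-≤ a (suc d) n a≤nd = <⇒≤pred (m<n*o⇒m/o<n (begin-strict
  a + d               <⟨ +-mono-≤-< a≤nd (n<1+n d) ⟩
  n * suc d + suc d   ≡⟨ +-comm (n * suc d) (suc d) ⟩
  suc n * suc d       ∎))
  where open ≤-Reasoning

ceilDiv-from-order-bound : ∀ r χ n → χ * r + n ≤ χ * n → ceilDiv (r * χ) (χ ∸ 1) ≤ n
ceilDiv-from-order-bound r zero    n _     = z≤n
ceilDiv-from-order-bound r (suc k) n bound = ceilDiv-≤ (r * suc k) k n (begin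
  r * suc k   ≡⟨ *-comm r (suc k) ⟩
  suc k * r   ≤⟨ +-cancelˡ-≤ n _ _ (subst (_≤ n + k * n) (+-comm (suc k * r) n) bound) ⟩
  k * n       ≡⟨ *-comm k n ⟩
  n * k       ∎)
  where open ≤-Reasoning

-- Every (r|χ)-graph with χ ≥ 1 has at least ⌈ r χ / (χ - 1) ⌉ vertices (the empty graph
-- has chromatic number 0).
lower-bound : ∀ r χ → 1 ≤ χ → (n : ℕ) (G : Graph n) → RChiGraph G r χ → ceilDiv (r * χ) (χ ∸ 1) ≤ n
lower-bound r χ 1≤χ zero    G (_ , _ , minimal)          = ⊥-elim (≤⇒≯ (minimal 0 ((λ ()) , λ ())) 1≤χ)
lower-bound r χ _   (suc n) G (regular , colourable , _) =
  ceilDiv-from-order-bound r χ (suc n) (order-bound G regular colourable (s≤s z≤n))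

clique-bound : ∀ {n m k} (G : Graph n) (ψ : Fin m → Fin n) →
  (∀ x y → x ≢ y → adj G (ψ x) (ψ y) ≡ true) → Colourable G k → m ≤ k
clique-bound G ψ clique (c , proper) = ≮⇒≥ λ k<m →
  let (x , y , x<y , same) = pigeonhole k<m (c ∘ ψ)
  in proper (ψ x) (ψ y) (clique x y (<⇒≢ᶠ x<y)) same

does-≟-sym : ∀ {n} (x y : Fin n) → does (x ≟ᶠ y) ≡ does (y ≟ᶠ x)
does-≟-sym x y with x ≟ᶠ y | y ≟ᶠ x
... | yes _  | yes _  = refl
... | no _   | no _   = refl
... | yes p  | no ¬q  = ⊥-elim (¬q (sym p))
... | no ¬p  | yes q  = ⊥-elim (¬p (sym q))

distinct-colours : ∀ {n} (c c' : Fin n) → not (does (c ≟ᶠ c')) ≡ true → c ≢ c'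
distinct-colours c c' adj refl with c ≟ᶠ c
distinct-colours c .c () refl | yes _
distinct-colours c .c adj refl | no c≢c = c≢c refl

right-conjunct : ∀ x {y} → x ∧ y ≡ true → y ≡ true
right-conjunct true y≡true = y≡true

module Blowup (k q b : ℕ) where

  χ : ℕ
  χ = suc k

  open Rotation χ

  cross : Fin χ → Fin χ → Bool
  cross c c' = (toℕ c + toℕ c') % χ <ᵇ b

  cross-sym : ∀ c c' → cross c c' ≡ cross c' c
  cross-sym c c' = cong (λ m → m % χ <ᵇ b) (+-comm (toℕ c) (toℕ c'))

  -- Each part is crossed with exactly b parts: they are the rotation by c of {0, …, b - 1}.
  cross-degree : b ≤ χ → ∀ c → ∑[ c' < χ ] ι (cross c c') ≡ b
  cross-degree b≤χ c = begin
    ∑[ c' < χ ] ι (cross c c')               ≡⟨ sum-cong-≗ {χ} (λ c' → cong (λ m → ι (m <ᵇ b)) (toℕ-fromℕ< (m%n<n (toℕ c + toℕ c') χ))) ⟨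
    ∑[ c' < χ ] ι (toℕ (rotate c c') <ᵇ b)   ≡⟨ ∑-rotate c (λ y → ι (toℕ y <ᵇ b)) ⟩
    ∑[ y < χ ] ι (toℕ y <ᵇ b)                ≡⟨ count-below χ b b≤χ ⟩
    b                                        ∎
    where open ≡-Reasoning

  -- Opposite parts c and k - c are never crossed, as (k - c + c) mod χ = k ≥ b.
  cross-opposite : b ≤ k → ∀ c → cross (opposite c) c ≢ true
  cross-opposite b≤k c cross≡true = <⇒≱ (<ᵇ⇒< _ b (subst T (sym cross≡true) tt)) (begin
    b                                ≤⟨ b≤k ⟩
    k                                ≡⟨ m<n⇒m%n≡m (n<1+n k) ⟨
    k % χ                            ≡⟨ cong (_% χ) (m∸n+n≡m (≤-pred (toℕ<n c))) ⟨
    (k ∸ toℕ c + toℕ c) % χ          ≡⟨ cong (λ m → (m + toℕ c) % χ) (opposite-prop c) ⟨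
    (toℕ (opposite c) + toℕ c) % χ   ∎)
    where open ≤-Reasoning

  -- Vertex (i , j , c) lies in copy i, row j and part c.
  Vertex : ℕ → Set
  Vertex t = Fin t × Fin q × Fin χ

  adjacent : ∀ {t} → Vertex t → Vertex t → Bool
  adjacent (i , j , c) (i' , j' , c') =
    if does (i ≟ᶠ i') then not (does (c ≟ᶠ c')) else does (j ≟ᶠ j') ∧ cross c c'

  adjacent-sym : ∀ {t} (x y : Vertex t) → adjacent x y ≡ adjacent y x
  adjacent-sym (i , j , c) (i' , j' , c')
    rewrite does-≟-sym i i' | does-≟-sym j j' | does-≟-sym c c' | cross-sym c c' = refl

  adjacent-irrefl : ∀ {t} (x : Vertex t) → adjacent x x ≡ false
  adjacent-irrefl (i , j , c) rewrite dec-true (i ≟ᶠ i) refl | dec-true (c ≟ᶠ c) refl = refl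

  own-copy-degree : ∀ {t} (i : Fin t) j c →
    ∑[ j' < q ] ∑[ c' < χ ] ι (adjacent (i , j , c) (i , j' , c')) ≡ q * k
  own-copy-degree i j c rewrite dec-true (i ≟ᶠ i) refl = begin
    ∑[ j' < q ] ∑[ c' < χ ] ι (not (does (c ≟ᶠ c')))   ≡⟨ sum-cong-≗ {q} (λ _ → ∑-spike c _ own-part other-part) ⟩
    ∑[ j' < q ] (0 + k * 1)                            ≡⟨ ∑-const q (k * 1) ⟩
    q * (k * 1)                                        ≡⟨ cong (q *_) (*-identityʳ k) ⟩
    q * k                                              ∎
    where
    open ≡-Reasoning
    own-part : ι (not (does (c ≟ᶠ c))) ≡ 0
    own-part rewrite dec-true (c ≟ᶠ c) refl = refl
    other-part : ∀ c' → c' ≢ c → ι (not (does (c ≟ᶠ c'))) ≡ 1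
    other-part c' c'≢c rewrite dec-false (c ≟ᶠ c') (c'≢c ∘ sym) = refl

  other-copy-degree : ∀ {t} (i i' : Fin t) j c → i' ≢ i → b ≤ χ →
    ∑[ j' < q ] ∑[ c' < χ ] ι (adjacent (i , j , c) (i' , j' , c')) ≡ b
  other-copy-degree i i' j c i'≢i b≤χ rewrite dec-false (i ≟ᶠ i') (i'≢i ∘ sym) = begin
    ∑[ j' < q ] ∑[ c' < χ ] ι (does (j ≟ᶠ j') ∧ cross c c')   ≡⟨ ∑-spike j _ own-row other-row ⟩
    b + (q ∸ 1) * 0                                          ≡⟨ cong (b +_) (*-zeroʳ (q ∸ 1)) ⟩
    b + 0                                                    ≡⟨ +-identityʳ b ⟩
    b                                                        ∎
    where
    open ≡-Reasoning
    own-row : ∑[ c' < χ ] ι (does (j ≟ᶠ j) ∧ cross c c') ≡ b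
    own-row rewrite dec-true (j ≟ᶠ j) refl = cross-degree b≤χ c
    other-row : ∀ j' → j' ≢ j → ∑[ c' < χ ] ι (does (j ≟ᶠ j') ∧ cross c c') ≡ 0
    other-row j' j'≢j rewrite dec-false (j ≟ᶠ j') (j'≢j ∘ sym) = trans (∑-const χ 0) (*-zeroʳ χ)

  vertex-degree : ∀ {t} → b ≤ χ → (x : Vertex t) →
    ∑[ i' < t ] ∑[ j' < q ] ∑[ c' < χ ] ι (adjacent x (i' , j' , c')) ≡ q * k + (t ∸ 1) * b
  vertex-degree b≤χ (i , j , c) =
    ∑-spike i _ (own-copy-degree i j c) (λ i' i'≢i → other-copy-degree i i' j c i'≢i b≤χ)

  encode : ∀ {t} → Vertex t → Fin (t * q * χ)
  encode (i , j , c) = combine (combine i j) c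

  decode : ∀ t → Fin (t * q * χ) → Vertex t
  decode t v = assocʳ′ (map₁ (remQuot q) (remQuot {t * q} χ v))

  decode-encode : ∀ {t} (x : Vertex t) → decode t (encode x) ≡ x
  decode-encode {t} (i , j , c) = begin
    decode t (encode (i , j , c))           ≡⟨ cong (λ p → assocʳ′ (map₁ (remQuot q) p)) (remQuot-combine (combine {t} {q} i j) c) ⟩
    assocʳ′ (remQuot q (combine i j) , c)   ≡⟨ cong (λ p → assocʳ′ (p , c)) (remQuot-combine i j) ⟩
    i , j , c                               ∎
    where open ≡-Reasoning

  blowup : ∀ t → Graph (t * q * χ)
  blowup t = record
    { adj      = λ u v → adjacent (decode t u) (decode t v)
    ; adj-sym  = λ u v → adjacent-sym (decode t u) (decode t v)
    ; loopless = λ v → adjacent-irrefl (decode t v)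
    }

  blowup-regular : ∀ t → b ≤ χ → Regular (blowup t) (q * k + (t ∸ 1) * b)
  blowup-regular t b≤χ v = begin
    degree (blowup t) v                                                         ≡⟨ degree≡∑ (blowup t) v ⟩
    ∑[ w < t * q * χ ] ι (adjacent x (decode t w))                              ≡⟨ ∑-combine (t * q) χ _ ⟩
    ∑[ l < t * q ] ∑[ c' < χ ] ι (adjacent x (decode t (combine l c')))         ≡⟨ ∑-combine t q _ ⟩
    ∑[ i' < t ] ∑[ j' < q ] ∑[ c' < χ ] ι (adjacent x (decode t (encode (i' , j' , c'))))
      ≡⟨ sum-cong-≗ {t} (λ i' → sum-cong-≗ {q} (λ j' → sum-cong-≗ {χ} (λ c' →
           cong (ι ∘ adjacent x) (decode-encode (i' , j' , c'))))) ⟩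
    ∑[ i' < t ] ∑[ j' < q ] ∑[ c' < χ ] ι (adjacent x (i' , j' , c'))           ≡⟨ vertex-degree b≤χ x ⟩
    q * k + (t ∸ 1) * b                                                         ∎
    where
    open ≡-Reasoning
    x = decode t v

  colour : ∀ {t} → Vertex t → Fin χ
  colour (zero  , _ , c) = c
  colour (suc _ , _ , c) = opposite c

  -- With at most two copies this colouring is proper: inside a copy adjacent vertices lie
  -- in different parts, and across copies equal colours mean opposite parts.
  colour-proper : ∀ {t} → t ≤ 2 → b ≤ k → ∀ (x y : Vertex t) → adjacent x y ≡ true → colour x ≢ colour y
  colour-proper _ _ (zero , _ , c) (zero , _ , c') adj same = distinct-colours c c' adj same
  colour-proper _ _ (suc zero , _ , c) (suc zero , _ , c') adj same =
    distinct-colours c c' adj (trans (sym (opposite-involutive c)) (trans (cong opposite same) (opposite-involutive c')))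
  colour-proper _ b≤k (zero , j , c) (suc _ , j' , c') adj refl =
    cross-opposite b≤k c' (right-conjunct (does (j ≟ᶠ j')) adj)
  colour-proper _ b≤k (suc _ , j , c) (zero , j' , c') adj refl =
    cross-opposite b≤k c (trans (cross-sym (opposite c) c) (right-conjunct (does (j ≟ᶠ j')) adj))
  colour-proper t≤2 _ (i@(suc (suc _)) , _) _ _ _ = ⊥-elim (≤⇒≯ t≤2 (≤-trans (s≤s (s≤s (s≤s z≤n))) (toℕ<n i)))
  colour-proper t≤2 _ (suc zero , _) (i@(suc (suc _)) , _) _ _ = ⊥-elim (≤⇒≯ t≤2 (≤-trans (s≤s (s≤s (s≤s z≤n))) (toℕ<n i)))

  -- For 1 ≤ t ≤ 2 and q ≥ 1 the blow-up has chromatic number exactly χ: the colouring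
  -- above is proper, and the χ parts of one row of copy 0 form a clique.
  blowup-chromatic : ∀ t → 1 ≤ t → t ≤ 2 → Fin q → b ≤ k → ChromaticNumber (blowup t) χ
  blowup-chromatic (suc t) _ t≤2 row b≤k =
    (colour ∘ decode (suc t) , λ u v → colour-proper t≤2 b≤k (decode (suc t) u) (decode (suc t) v)) ,
    λ _ → clique-bound (blowup (suc t)) clique clique-adjacent
    where
    clique : Fin χ → Fin (suc t * q * χ)
    clique c = encode {suc t} (zero , row , c)
    clique-adjacent : ∀ c c' → c ≢ c' → adj (blowup (suc t)) (clique c) (clique c') ≡ true
    clique-adjacent c c' c≢c' = begin
      adjacent (decode (suc t) (clique c)) (decode (suc t) (clique c'))
        ≡⟨ cong₂ adjacent (decode-encode (zero , row , c)) (decode-encode (zero , row , c')) ⟩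
      not (does (c ≟ᶠ c'))   ≡⟨ cong not (dec-false (c ≟ᶠ c') c≢c') ⟩
      true                   ∎
      where open ≡-Reasoning

copies : ∀ b r → b ≤ r → ∃ λ t → 1 ≤ t × t ≤ 2 × t ≤ b + 1 × (r ∸ b) + (t ∸ 1) * b ≡ r
copies zero    r _   = 1 , ≤-refl , s≤s z≤n , ≤-refl , +-identityʳ r
copies (suc b) r b<r = 2 , s≤s z≤n , ≤-refl , s≤s (m≤n+m 1 b) ,
  trans (cong ((r ∸ suc b) +_) (+-identityʳ (suc b))) (m∸n+n≡m b<r)

≤-floorDiv : ∀ m a d → m * suc d ≤ a → m ≤ floorDiv a (suc d)
≤-floorDiv m a d md≤a = subst (_≤ a / suc d) (m*n/n≡m m (suc d)) (/-monoˡ-≤ (suc d) md≤a)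

order-bounds : ∀ r b d q t → r ∸ b ≡ q * suc d → t ≤ 2 → t ≤ b + 1 →
  t * q * suc (suc d) ≤ (2 * floorDiv (r * suc (suc d)) (suc d)) ⊓ (floorDiv (r ∸ b) (suc d) * suc (suc d) * (b + 1))
order-bounds r b d q t r-b≡qk t≤2 t≤b+1 = ⊓-glb two-copies-bound copies-bound
  where
  open ≤-Reasoning
  χ = suc (suc d)
  k = suc d
  qχ≤⌊rχ/k⌋ : q * χ ≤ floorDiv (r * χ) k
  qχ≤⌊rχ/k⌋ = ≤-floorDiv (q * χ) (r * χ) d (begin
    q * χ * k     ≡⟨ xy∙z≈xz∙y q χ k ⟩
    q * k * χ     ≡⟨ cong (_* χ) r-b≡qk ⟨
    (r ∸ b) * χ   ≤⟨ *-monoˡ-≤ χ (m∸n≤m r b) ⟩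
    r * χ         ∎)
  ⌊[r-b]/k⌋≡q : floorDiv (r ∸ b) k ≡ q
  ⌊[r-b]/k⌋≡q = trans (cong (_/ k) r-b≡qk) (m*n/n≡m q k)
  two-copies-bound : t * q * χ ≤ 2 * floorDiv (r * χ) k
  two-copies-bound = begin
    t * q * χ                  ≡⟨ *-assoc t q χ ⟩
    t * (q * χ)                ≤⟨ *-mono-≤ t≤2 qχ≤⌊rχ/k⌋ ⟩
    2 * floorDiv (r * χ) k     ∎
  copies-bound : t * q * χ ≤ floorDiv (r ∸ b) k * χ * (b + 1)
  copies-bound = begin
    t * q * χ                          ≡⟨ xy∙z≈yz∙x t q χ ⟩
    q * χ * t                          ≤⟨ *-monoʳ-≤ (q * χ) t≤b+1 ⟩
    q * χ * (b + 1)                    ≡⟨ cong (λ m → m * χ * (b + 1)) ⌊[r-b]/k⌋≡q ⟨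
    floorDiv (r ∸ b) k * χ * (b + 1)   ∎

upper-bound : ∀ r χ b → 2 ≤ χ → b < χ → (χ ∸ 1) ∣ (r ∸ b) → χ ∸ 1 ≤ r ∸ b →
  Σ ℕ (λ n → Σ (Graph n) (λ G → RChiGraph G r χ
    × n ≤ (2 * floorDiv (r * χ) (χ ∸ 1)) ⊓ (floorDiv (r ∸ b) (χ ∸ 1) * χ * (b + 1))))
upper-bound r (suc zero)    b (s≤s ()) _ _ _
upper-bound r (suc (suc d)) b _ _ (divides zero r-b≡0) k≤r-b = ⊥-elim (n≮0 (subst (suc d ≤_) r-b≡0 k≤r-b))
upper-bound r (suc (suc d)) b _ (s≤s b≤k) (divides q@(suc _) r-b≡qk) k≤r-b with copies b r b≤r
  where
  b≤r : b ≤ r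
  b≤r = <⇒≤ (m∸n≢0⇒n<m λ r-b≡0 → n≮0 (subst (suc d ≤_) r-b≡0 k≤r-b))
... | t , 1≤t , t≤2 , t≤b+1 , degree≡r =
  t * q * χ , blowup t , (regular , blowup-chromatic t 1≤t t≤2 zero b≤k) , order-bounds r b d q t r-b≡qk t≤2 t≤b+1
  where
  open Blowup (suc d) q b
  regular : Regular (blowup t) r
  regular = subst (Regular (blowup t)) (trans (cong (_+ (t ∸ 1) * b) (sym r-b≡qk)) degree≡r)
                  (blowup-regular t (m≤n⇒m≤1+n b≤k))

theorem7 : (r χ b : ℕ) → 2 ≤ χ → χ ≤ r + 1 → b < χ → (χ ∸ 1) ∣ (r ∸ b) → χ ∸ 1 ≤ r ∸ b →
    ((n : ℕ) (G : Graph n) → RChiGraph G r χ → ceilDiv (r * χ) (χ ∸ 1) ≤ n)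
    × Σ ℕ (λ n → Σ (Graph n) (λ G → RChiGraph G r χ
    × n ≤ (2 * floorDiv (r * χ) (χ ∸ 1)) ⊓ (floorDiv (r ∸ b) (χ ∸ 1) * χ * (b + 1))))
theorem7 r χ b 2≤χ _ b<χ χ-1∣r-b χ-1≤r-b =
  lower-bound r χ (<⇒≤ 2≤χ) , upper-bound r χ b 2≤χ b<χ χ-1∣r-b χ-1≤r-b
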